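{- For any positive integers $a, b, c, d$, we have \[S(ac - 1, bd - 1) \ge S(a-1, b-1)\, S(c-1, d-1).\]
   Context: A permutation of length $n\ge0$ is a bijection $\pi$ of $[n]$, written as $\pi(1)\ldots\pi(n)$. $\pi$ contains $\tau$ ($\tau$ is a pattern of $\pi$) if $\pi$ has a subsequence in the same relative order as $\tau$; proper if $\tau$ is shorter than $\pi$. $\mathbb N=\{0,1,2,\dots\}$. For $r,s\in\mathbb N$, $\pi$ is $(r,s)$-coverable if its terms can be partitioned into $r$ increasing and $s$ decreasing (possibly empty) subsequences; $\pi$ is $(r,s)$-critical if it is not $(r,s)$-coverable but every proper pattern is. $\pi$ is $(r,s)$-sharp if it is $(r,s)$-critical and $(0,s+1)$-coverable. $S(r,s)$ is the supremum (in $\mathbb N\cup\{\infty\}$, with $\sup\emptyset=0$) of the lengths of $(r,s)$-sharp permutations. -}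

module Defs where

open import Data.Nat using (ℕ; zero; suc; _+_; _*_; _≤_; _<_)
open import Data.Fin using (Fin; toℕ) renaming (_<_ to _<ᶠ_)
open import Data.Product using (Σ; ∃; _×_; _,_)
open import Data.Sum using (_⊎_)
open import Relation.Nullary using (¬_)
open import Relation.Binary.PropositionalEquality using (_≡_)
open import Function.Definitions using (Bijective)

record Perm (n : ℕ) : Set where
  constructor perm
  field
    fun : Fin n → Fin n
    bij : Bijective _≡_ _≡_ fun
open Perm public

Contains : ∀ {n k} → Perm n → Perm k → Set
Contains {n} {k} π τ =
  Σ (Fin k → Fin n) λ e →
    (∀ i j → i <ᶠ j → e i <ᶠ e j) ×
    (∀ i j → (fun τ i <ᶠ fun τ j → fun π (e i) <ᶠ fun π (e j))
           × (fun π (e i) <ᶠ fun π (e j) → fun τ i <ᶠ fun τ j))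

-- (r,s)-coverable: the terms can be partitioned into r increasing and
-- s decreasing (possibly empty) subsequences.
Coverable : ℕ → ℕ → ∀ {n} → Perm n → Set
Coverable r s {n} π =
  Σ (Fin n → Fin (r + s)) λ col →
    ∀ i j → i <ᶠ j → col i ≡ col j →
      (toℕ (col i) < r → fun π i <ᶠ fun π j) ×
      (¬ (toℕ (col i) < r) → fun π j <ᶠ fun π i)

Critical : ℕ → ℕ → ∀ {n} → Perm n → Set
Critical r s {n} π =
  ¬ Coverable r s π ×
  (∀ k (τ : Perm k) → k < n → Contains π τ → Coverable r s τ)

Sharp : ℕ → ℕ → ∀ {n} → Perm n → Set
Sharp r s π = Critical r s π × Coverable 0 (suc s) π

-- "S(r,s) ≥ N" where S(r,s) ∈ ℕ ∪ {∞} is the supremum of lengths of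
-- (r,s)-sharp permutations (sup ∅ = 0):  N = 0, or some (r,s)-sharp
-- permutation has length ≥ N.
S≥ : ℕ → ℕ → ℕ → Set
S≥ r s N = N ≡ 0 ⊎ Σ ℕ λ n → Σ (Perm n) λ π → Sharp r s π × N ≤ n

-- The bound is attained by the inflation σ[τ], which replaces each entry of σ by a block
-- order-isomorphic to τ.  Pairing decreasing covers of σ and τ covers σ[τ] by bd decreasing
-- sequences.  In an (ac − 1, bd − 1)-cover of σ[τ] each block is a copy of τ, so it uses at least c
-- increasing or at least d decreasing colours.  Count, for each block, the increasing colours used
-- along descents of σ ending there (the decreasing ones along ascents); this count grows by at least
-- c (resp. d) along such chains, so grouping it c (resp. d) at a time yields an (a − 1, b − 1)-cover
-- of σ, which does not exist.  After deleting a point (i, j), covers of σ − i and τ − j combine into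
-- an (ac − 1, bd − 1)-cover: increasing colours come from pairs of increasing classes, and each block
-- takes its decreasing colours from a window below a level that grows along ascents of σ.
-- In the code a, b, c, d stand for a − 1, b − 1, c − 1, d − 1, so ac − 1 is c + a * suc c.

module Submission where

open import Defs
open import Data.Fin as Fin
  using (Fin; toℕ; fromℕ<; join; splitAt; _↑ˡ_; _↑ʳ_; combine; quotient; remainder; punchIn; punchOut)
  renaming (_<_ to _<ᶠ_; _≤_ to _≤ᶠ_)
open import Data.Fin.Properties
  using ( any?; ¬∀⟶∃¬; injective⇒≤; <-cmp; ≤∧≢⇒<; toℕ<n; toℕ-injective; toℕ-fromℕ<; fromℕ<-injective
        ; toℕ-↑ˡ; toℕ-↑ʳ; ↑ˡ-injective; ↑ʳ-injective; splitAt⁻¹-↑ˡ; splitAt⁻¹-↑ʳ; splitAt-join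
        ; toℕ-combine; combine-monoˡ-<; combine-injective; combine-injectiveˡ; combine-injectiveʳ; combine-remQuot; remQuot-combine
        ; punchIn-injective; punchInᵢ≢i; punchIn-mono-≤; punchOut-cong; punchOut-injective; punchOut-mono-≤
        ; punchOut-cancel-≤; punchIn-punchOut; punchOut-punchIn )
  renaming (_≟_ to _≟ᶠ_; _<?_ to _<ᶠ?_; <⇒≢ to <ᶠ⇒≢)
open import Data.Maybe using (Maybe; just; nothing)
import Data.Maybe as Maybe
import Data.Maybe.Properties as Maybe
open import Data.Nat using (ℕ; zero; suc; _+_; _*_; _∸_; _/_; _≤_; _<_; _≤?_; z≤n; s≤s)
open import Data.Nat.DivMod using (m<n*o⇒m/o<n; m/n≡1+[m∸n]/n; /-monoˡ-≤)
open import Data.Nat.Properties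
  using ( ≤-refl; ≤-trans; ≤-reflexive; ≤-pred; <-trans; <-≤-trans; <-irrefl; <-asym; <⇒≤; <⇒≢; <⇒≱; ≤⇒≯; ≰⇒>; n<1+n
        ; m≤m+n; m≤n+m; m≤n⇒m≤1+n; +-comm; +-mono-≤; +-monoʳ-≤; +-monoʳ-<; +-cancelˡ-≡; +-cancelˡ-<
        ; *-identityʳ; *-monoʳ-≤; ∸-monoˡ-<; m+n∸m≡n; m+n≤o⇒m≤o∸n; m∸n+n≡m; module ≤-Reasoning )
import Data.Nat.Properties as ℕ
open import Algebra.Properties.CommutativeSemigroup ℕ.+-commutativeSemigroup using (interchange)
open import Data.Nat.Solver using (module +-*-Solver)
open +-*-Solver using (solve; _:+_; _:*_; _:=_; con)
open import Data.Product using (Σ; ∃; _×_; _,_; proj₁; proj₂)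
open import Data.Sum using (_⊎_; inj₁; inj₂)
import Data.Sum as Sum
import Data.Sum.Properties as Sum
open import Function using (_∘_; id)
open import Function.Definitions using (Injective)
open import Level using (Level)
open import Relation.Binary using (tri<; tri≈; tri>)
open import Relation.Binary.PropositionalEquality using (_≡_; _≢_; refl; sym; trans; cong; cong₂; subst; subst₂)
open import Relation.Nullary using (¬_; Dec; yes; no; contradiction)
open import Relation.Nullary.Decidable using (_×-dec_; _⊎-dec_)
open import Relation.Unary using (Pred; Decidable; _⊆_; ∅; ｛_｝; _⊥_)
open import Relation.Unary.Properties using (_∩?_)

private
  variable
    ℓ ℓ′ ℓ″ : Level
    m n r s : ℕ
    A A′ B B′ : Set

-- Counting the elements of a decidable subset of Fin n

indicator : ∀ {ℓ} {A : Set ℓ} → Dec A → ℕ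
indicator (yes _) = 1
indicator (no _)  = 0

count : {P : Pred (Fin n) ℓ} → Decidable P → ℕ
count {zero}  P? = 0
count {suc n} P? = indicator (P? Fin.zero) + count (P? ∘ Fin.suc)

count≤n : {P : Pred (Fin n) ℓ} (P? : Decidable P) → count P? ≤ n
count≤n {zero}  P? = z≤n
count≤n {suc n} P? with P? Fin.zero
... | yes _ = s≤s (count≤n (P? ∘ Fin.suc))
... | no  _ = m≤n⇒m≤1+n (count≤n (P? ∘ Fin.suc))

count-pos : {P : Pred (Fin n) ℓ} (P? : Decidable P) {x : Fin n} → P x → 0 < count P?
count-pos P? {Fin.zero} px with P? Fin.zero
... | yes _  = s≤s z≤n
... | no ¬px = contradiction px ¬px
count-pos P? {Fin.suc x} px = ≤-trans (count-pos (P? ∘ Fin.suc) px) (m≤n+m _ (indicator (P? Fin.zero)))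

indicator-⊎ : ∀ {a b c} {A : Set a} {B : Set b} {C : Set c} (A? : Dec A) (B? : Dec B) (C? : Dec C) →
  ¬ (A × B) → (A → C) → (B → C) → indicator A? + indicator B? ≤ indicator C?
indicator-⊎ (yes a) (yes b) _       ¬ab _   _   = contradiction (a , b) ¬ab
indicator-⊎ (yes a) (no _)  (yes _) _   _   _   = ≤-refl
indicator-⊎ (yes a) (no _)  (no ¬c) _   a⇒c _   = contradiction (a⇒c a) ¬c
indicator-⊎ (no _)  (yes _) (yes _) _   _   _   = ≤-refl
indicator-⊎ (no _)  (yes b) (no ¬c) _   _   b⇒c = contradiction (b⇒c b) ¬c
indicator-⊎ (no _)  (no _)  _       _   _   _   = z≤n

count-⊎ : {P : Pred (Fin n) ℓ} {Q : Pred (Fin n) ℓ′} {R : Pred (Fin n) ℓ″}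
  (P? : Decidable P) (Q? : Decidable Q) (R? : Decidable R) →
  P ⊥ Q → P ⊆ R → Q ⊆ R → count P? + count Q? ≤ count R?
count-⊎ {zero}  P? Q? R? P⊥Q P⊆R Q⊆R = z≤n
count-⊎ {suc n} P? Q? R? P⊥Q P⊆R Q⊆R =
  subst (_≤ count R?)
    (interchange (indicator (P? Fin.zero)) (indicator (Q? Fin.zero)) (count (P? ∘ Fin.suc)) (count (Q? ∘ Fin.suc)))
    (+-mono-≤ (indicator-⊎ (P? Fin.zero) (Q? Fin.zero) (R? Fin.zero) P⊥Q P⊆R Q⊆R)
              (count-⊎ (P? ∘ Fin.suc) (Q? ∘ Fin.suc) (R? ∘ Fin.suc) P⊥Q P⊆R Q⊆R))

indicator-mono : ∀ {a b} {A : Set a} {B : Set b} (A? : Dec A) (B? : Dec B) → (A → B) → indicator A? ≤ indicator B?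
indicator-mono (yes a) (yes _) _   = ≤-refl
indicator-mono (yes a) (no ¬b) a⇒b = contradiction (a⇒b a) ¬b
indicator-mono (no _)  _       _   = z≤n

count-mono : {P : Pred (Fin n) ℓ} {Q : Pred (Fin n) ℓ′} (P? : Decidable P) (Q? : Decidable Q) →
  P ⊆ Q → count P? ≤ count Q?
count-mono {zero}  P? Q? P⊆Q = z≤n
count-mono {suc n} P? Q? P⊆Q =
  +-mono-≤ (indicator-mono (P? Fin.zero) (Q? Fin.zero) P⊆Q) (count-mono (P? ∘ Fin.suc) (Q? ∘ Fin.suc) P⊆Q)

count-< : {P : Pred (Fin n) ℓ} {Q : Pred (Fin n) ℓ′} (P? : Decidable P) (Q? : Decidable Q) {x : Fin n} →
  P ⊆ Q → Q x → ¬ P x → count P? < count Q?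
count-< P? Q? {x} P⊆Q qx ¬px = ≤-trans
  (subst (_≤ count P? + count (_≟ᶠ x)) (+-comm (count P?) 1) (+-mono-≤ (≤-refl {count P?}) (count-pos (_≟ᶠ x) refl)))
  (count-⊎ P? (_≟ᶠ x) Q? (λ { (px , refl) → ¬px px }) P⊆Q (λ { refl → qx }))

module _ {P : Pred (Fin n) ℓ} (P? : Decidable P) where

  rank : Fin n → ℕ
  rank x = count (P? ∩? (_<ᶠ? x))

  rank<count : ∀ {x} → P x → rank x < count P?
  rank<count px = count-< (P? ∩? (_<ᶠ? _)) P? proj₁ px λ (_ , x<x) → <-irrefl refl x<x

  rank-mono : ∀ {x y} → P x → x <ᶠ y → rank x < rank y
  rank-mono px x<y = count-< (P? ∩? (_<ᶠ? _)) (P? ∩? (_<ᶠ? _))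
    (λ (pz , z<x) → pz , <-trans z<x x<y) (px , x<y) λ (_ , x<x) → <-irrefl refl x<x

  rank-injective : ∀ {x y} → P x → P y → rank x ≡ rank y → x ≡ y
  rank-injective {x} {y} px py eq with <-cmp x y
  ... | tri< x<y _ _ = contradiction eq (<⇒≢ (rank-mono px x<y))
  ... | tri≈ _ x≡y _ = x≡y
  ... | tri> _ _ y<x = contradiction (sym eq) (<⇒≢ (rank-mono py y<x))

fun-injective : (π : Perm n) → Injective _≡_ _≡_ (fun π)
fun-injective π = proj₁ (bij π)

ascent-or-descent : (π : Perm n) {x y : Fin n} → x <ᶠ y → fun π x <ᶠ fun π y ⊎ fun π y <ᶠ fun π x
ascent-or-descent π {x} {y} x<y with <-cmp (fun π x) (fun π y)
... | tri< πx<πy _ _ = inj₁ πx<πy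
... | tri≈ _ πx≡πy _ = contradiction (fun-injective π πx≡πy) (<ᶠ⇒≢ x<y)
... | tri> _ _ πy<πx = inj₂ πy<πx

module _ (π : Perm n) where

  Increasing Decreasing : ∀ {ℓ} → Pred (Fin n) ℓ → Set ℓ
  Increasing P = ∀ {x y} → P x → P y → x <ᶠ y → fun π x <ᶠ fun π y
  Decreasing P = ∀ {x y} → P x → P y → x <ᶠ y → fun π y <ᶠ fun π x

  Ascent Descent : Fin n → Fin n → Set
  Ascent  x y = x <ᶠ y × fun π x <ᶠ fun π y
  Descent x y = x <ᶠ y × fun π y <ᶠ fun π x

  ascent-trans : ∀ {x y z} → Ascent x y → Ascent y z → Ascent x z
  ascent-trans (x<y , πx<πy) (y<z , πy<πz) = <-trans x<y y<z , <-trans πx<πy πy<πz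

  descent-trans : ∀ {x y z} → Descent x y → Descent y z → Descent x z
  descent-trans (x<y , πy<πx) (y<z , πz<πy) = <-trans x<y y<z , <-trans πz<πy πy<πx

  ascent? : ∀ x y → Dec (Ascent x y)
  ascent? x y = (x <ᶠ? y) ×-dec (fun π x <ᶠ? fun π y)

  descent? : ∀ x y → Dec (Descent x y)
  descent? x y = (x <ᶠ? y) ×-dec (fun π y <ᶠ? fun π x)

ascent-unless-descent : (π : Perm n) {x y : Fin n} → x <ᶠ y → ¬ Descent π x y → fun π x <ᶠ fun π y
ascent-unless-descent π x<y ¬descent with ascent-or-descent π x<y
... | inj₁ πx<πy = πx<πy
... | inj₂ πy<πx = contradiction (x<y , πy<πx) ¬descent

descent-unless-ascent : (π : Perm n) {x y : Fin n} → x <ᶠ y → ¬ Ascent π x y → fun π y <ᶠ fun π x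
descent-unless-ascent π x<y ¬ascent with ascent-or-descent π x<y
... | inj₁ πx<πy = contradiction (x<y , πx<πy) ¬ascent
... | inj₂ πy<πx = πy<πx

-- Covers as colourings

record Colouring (A B : Set) (π : Perm n) : Set where
  field
    colour     : Fin n → Maybe (A ⊎ B)
    increasing : ∀ a → Increasing π (λ x → colour x ≡ just (inj₁ a))
    decreasing : ∀ b → Decreasing π (λ x → colour x ≡ just (inj₂ b))

  Uncoloured : Pred (Fin n) _
  Uncoloured x = colour x ≡ nothing

open Colouring public

CoverableAway : ℕ → ℕ → Perm n → Fin n → Set
CoverableAway r s π p = Σ (Colouring (Fin r) (Fin s) π) λ C → Uncoloured C ⊆ ｛ p ｝

fromJust : (x : Maybe A) → x ≢ nothing → A
fromJust (just a) _  = a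
fromJust nothing  x≢ = contradiction refl x≢

fromJust-just : (x : Maybe A) (x≢ : x ≢ nothing) → x ≡ just (fromJust x x≢)
fromJust-just (just a) _  = refl
fromJust-just nothing  x≢ = contradiction refl x≢

↑ˡ-< : (a : Fin r) (s : ℕ) → toℕ (a ↑ˡ s) < r
↑ˡ-< {r} a s = subst (_< r) (sym (toℕ-↑ˡ a s)) (toℕ<n a)

↑ʳ-≮ : (r : ℕ) (b : Fin s) → ¬ (toℕ (r ↑ʳ b) < r)
↑ʳ-≮ r b lt = <⇒≱ lt (subst (r ≤_) (sym (toℕ-↑ʳ r b)) (m≤m+n r (toℕ b)))

module _ {π : Perm n} where

  coverable⇒colouring : Coverable r s π → Σ (Colouring (Fin r) (Fin s) π) λ C → Uncoloured C ⊆ ∅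
  coverable⇒colouring {r} {s} (col , ordered) = C , λ ()
    where
    C : Colouring (Fin r) (Fin s) π
    C .colour x = just (splitAt r (col x))
    C .increasing a {x} {y} cx cy x<y =
      proj₁ (ordered x y x<y (trans (sym a≡x) a≡y)) (subst (λ c → toℕ c < r) a≡x (↑ˡ-< a s))
      where
      a≡x = splitAt⁻¹-↑ˡ (Maybe.just-injective cx)
      a≡y = splitAt⁻¹-↑ˡ (Maybe.just-injective cy)
    C .decreasing b {x} {y} cx cy x<y =
      proj₂ (ordered x y x<y (trans (sym b≡x) b≡y)) (subst (λ c → ¬ (toℕ c < r)) b≡x (↑ʳ-≮ r b))
      where
      b≡x = splitAt⁻¹-↑ʳ (Maybe.just-injective cx)
      b≡y = splitAt⁻¹-↑ʳ (Maybe.just-injective cy)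

  colouring⇒coverable : (C : Colouring (Fin r) (Fin s) π) → Uncoloured C ⊆ ∅ → Coverable r s π
  colouring⇒coverable {r} {s} C total = join r s ∘ c , λ x y x<y eq →
    ordered (c x) (fromJust-just _ total) (trans (fromJust-just _ total) (cong just (sym (join-injective eq)))) x<y
    where
    c : Fin n → Fin r ⊎ Fin s
    c x = fromJust (colour C x) total
    join-injective : ∀ {u v} → join r s u ≡ join r s v → u ≡ v
    join-injective {u} {v} eq = trans (sym (splitAt-join r s u)) (trans (cong (splitAt r) eq) (splitAt-join r s v))
    ordered : ∀ {x y} (u : Fin r ⊎ Fin s) → colour C x ≡ just u → colour C y ≡ just u → x <ᶠ y →
      (toℕ (join r s u) < r → fun π x <ᶠ fun π y) × (¬ (toℕ (join r s u) < r) → fun π y <ᶠ fun π x)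
    ordered (inj₁ a) cx cy x<y = (λ _ → increasing C a cx cy x<y) , λ ¬lt → contradiction (↑ˡ-< a s) ¬lt
    ordered (inj₂ b) cx cy x<y = (λ lt → contradiction lt (↑ʳ-≮ r b)) , λ _ → decreasing C b cx cy x<y

module _ {f : A → A′} {g : B → B′} where

  map-inj₁ : ∀ (u : Maybe (A ⊎ B)) {a′} → Maybe.map (Sum.map f g) u ≡ just (inj₁ a′) →
    ∃ λ a → u ≡ just (inj₁ a) × f a ≡ a′
  map-inj₁ (just (inj₁ a)) refl = a , refl , refl

  map-inj₂ : ∀ (u : Maybe (A ⊎ B)) {b′} → Maybe.map (Sum.map f g) u ≡ just (inj₂ b′) →
    ∃ λ b → u ≡ just (inj₂ b) × g b ≡ b′
  map-inj₂ (just (inj₂ b)) refl = b , refl , refl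

module _ {π : Perm n} {f : A → A′} {g : B → B′} (f-inj : Injective _≡_ _≡_ f) (g-inj : Injective _≡_ _≡_ g) where

  recolour : Colouring A B π → Colouring A′ B′ π
  recolour C .colour = Maybe.map (Sum.map f g) ∘ colour C
  recolour C .increasing _ cx cy x<y with map-inj₁ {f = f} {g} _ cx | map-inj₁ {f = f} {g} _ cy
  ... | a , cx′ , refl | _ , cy′ , fa′≡fa rewrite f-inj fa′≡fa = increasing C a cx′ cy′ x<y
  recolour C .decreasing _ cx cy x<y with map-inj₂ {f = f} {g} _ cx | map-inj₂ {f = f} {g} _ cy
  ... | b , cx′ , refl | _ , cy′ , gb′≡gb rewrite g-inj gb′≡gb = decreasing C b cx′ cy′ x<y

  recolour-uncoloured : (C : Colouring A B π) → Uncoloured (recolour C) ⊆ Uncoloured C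
  recolour-uncoloured C {x} eq with colour C x
  ... | nothing = refl

newClass : Maybe (Fin r ⊎ B) → Fin (suc r) ⊎ B
newClass nothing         = inj₁ Fin.zero
newClass (just (inj₁ a)) = inj₁ (Fin.suc a)
newClass (just (inj₂ b)) = inj₂ b

newClass-zero : (u : Maybe (Fin r ⊎ B)) → newClass u ≡ inj₁ Fin.zero → u ≡ nothing
newClass-zero nothing         _  = refl
newClass-zero (just (inj₁ _)) ()
newClass-zero (just (inj₂ _)) ()

newClass-suc : (u : Maybe (Fin r ⊎ B)) {a : Fin r} → newClass u ≡ inj₁ (Fin.suc a) → u ≡ just (inj₁ a)
newClass-suc nothing         ()
newClass-suc (just (inj₁ _)) refl = refl
newClass-suc (just (inj₂ _)) ()

newClass-inj₂ : (u : Maybe (Fin r ⊎ B)) {b : B} → newClass u ≡ inj₂ b → u ≡ just (inj₂ b)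
newClass-inj₂ nothing         ()
newClass-inj₂ (just (inj₁ _)) ()
newClass-inj₂ (just (inj₂ _)) refl = refl

module _ {π : Perm n} where

  extend : (C : Colouring (Fin r) B π) {p : Fin n} → Uncoloured C ⊆ ｛ p ｝ → Colouring (Fin (suc r)) B π
  extend C uncoloured .colour x = just (newClass (colour C x))
  extend C uncoloured .increasing Fin.zero cx cy x<y = contradiction
    (trans (sym (uncoloured (newClass-zero _ (Maybe.just-injective cx)))) (uncoloured (newClass-zero _ (Maybe.just-injective cy))))
    (<ᶠ⇒≢ x<y)
  extend C uncoloured .increasing (Fin.suc a) cx cy =
    increasing C a (newClass-suc _ (Maybe.just-injective cx)) (newClass-suc _ (Maybe.just-injective cy))
  extend C uncoloured .decreasing b cx cy =
    decreasing C b (newClass-inj₂ _ (Maybe.just-injective cx)) (newClass-inj₂ _ (Maybe.just-injective cy))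

DecreasingCover : ℕ → Perm n → Set
DecreasingCover {n} s π = Σ (Fin n → Fin s) λ g → ∀ c → Decreasing π (λ x → g x ≡ c)

module _ {π : Perm n} where

  decreasingCover : Coverable 0 s π → DecreasingCover s π
  decreasingCover (col , ordered) = col , λ _ gx gy x<y → proj₂ (ordered _ _ x<y (trans gx (sym gy))) λ ()

  decreasingCover⇒coverable : DecreasingCover s π → Coverable 0 s π
  decreasingCover⇒coverable (g , decreasing) = g , λ x y x<y gx≡gy → (λ ()) , λ _ → decreasing (g x) refl (sym gx≡gy) x<y

  decreasingColouring : DecreasingCover s π → Colouring A (Fin s) π
  decreasingColouring (g , _) .colour = just ∘ inj₂ ∘ g
  decreasingColouring _ .increasing _ ()
  decreasingColouring (g , decreasing) .decreasing b cx cy =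
    decreasing b (Sum.inj₂-injective (Maybe.just-injective cx)) (Sum.inj₂-injective (Maybe.just-injective cy))

module _ {π : Perm n} (C : Colouring (Fin r) (Fin s) π) where

  UsedInc : Pred (Fin r) _
  UsedInc a = ∃ λ x → colour C x ≡ just (inj₁ a)

  UsedDec : Pred (Fin s) _
  UsedDec b = ∃ λ x → colour C x ≡ just (inj₂ b)

  private
    _≟colour_ : (u v : Maybe (Fin r ⊎ Fin s)) → Dec (u ≡ v)
    _≟colour_ = Maybe.≡-dec (Sum.≡-dec _≟ᶠ_ _≟ᶠ_)

  usedInc? : Decidable UsedInc
  usedInc? a = any? λ x → colour C x ≟colour just (inj₁ a)

  usedDec? : Decidable UsedDec
  usedDec? b = any? λ x → colour C x ≟colour just (inj₂ b)

  compress : ∀ {r′ s′} → count usedInc? ≤ r′ → count usedDec? ≤ s′ →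
    Σ (Colouring (Fin r′) (Fin s′) π) λ C′ → Uncoloured C′ ⊆ Uncoloured C
  compress {r′} {s′} few-inc few-dec = C′ , λ {x} → shrink-nothing x _ refl
    where
    shrink : ∀ x u → colour C x ≡ u → Maybe (Fin r′ ⊎ Fin s′)
    shrink x nothing         _  = nothing
    shrink x (just (inj₁ a)) cx = just (inj₁ (fromℕ< (<-≤-trans (rank<count usedInc? (x , cx)) few-inc)))
    shrink x (just (inj₂ b)) cx = just (inj₂ (fromℕ< (<-≤-trans (rank<count usedDec? (x , cx)) few-dec)))

    shrink-inj₁ : ∀ x u (cx : colour C x ≡ u) {a′} → shrink x u cx ≡ just (inj₁ a′) →
      ∃ λ a → colour C x ≡ just (inj₁ a) × rank usedInc? a ≡ toℕ a′
    shrink-inj₁ x (just (inj₁ a)) cx refl = a , cx , sym (toℕ-fromℕ< _)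

    shrink-inj₂ : ∀ x u (cx : colour C x ≡ u) {b′} → shrink x u cx ≡ just (inj₂ b′) →
      ∃ λ b → colour C x ≡ just (inj₂ b) × rank usedDec? b ≡ toℕ b′
    shrink-inj₂ x (just (inj₂ b)) cx refl = b , cx , sym (toℕ-fromℕ< _)

    shrink-nothing : ∀ x u (cx : colour C x ≡ u) → shrink x u cx ≡ nothing → colour C x ≡ nothing
    shrink-nothing x nothing         cx _  = cx
    shrink-nothing x (just (inj₁ _)) _  ()
    shrink-nothing x (just (inj₂ _)) _  ()

    C′ : Colouring (Fin r′) (Fin s′) π
    C′ .colour x = shrink x (colour C x) refl
    C′ .increasing _ {x} {y} cx cy x<y with shrink-inj₁ x _ refl cx | shrink-inj₁ y _ refl cy
    ... | a , cx′ , rank-a | a₂ , cy′ , rank-a₂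
      with refl ← rank-injective usedInc? (y , cy′) (x , cx′) (trans rank-a₂ (sym rank-a)) = increasing C a cx′ cy′ x<y
    C′ .decreasing _ {x} {y} cx cy x<y with shrink-inj₂ x _ refl cx | shrink-inj₂ y _ refl cy
    ... | b , cx′ , rank-b | b₂ , cy′ , rank-b₂
      with refl ← rank-injective usedDec? (y , cy′) (x , cx′) (trans rank-b₂ (sym rank-b)) = decreasing C b cx′ cy′ x<y

-- Patterns and deleted points

restrict : ∀ {k} {π : Perm n} {ρ : Perm k} → Contains π ρ → Colouring A B π → Colouring A B ρ
restrict (e , _ , _) C .colour = colour C ∘ e
restrict (e , e-mono , e-iso) C .increasing a cx cy x<y = proj₂ (e-iso _ _) (increasing C a cx cy (e-mono _ _ x<y))
restrict (e , e-mono , e-iso) C .decreasing b cx cy x<y = proj₂ (e-iso _ _) (decreasing C b cx cy (e-mono _ _ x<y))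

proper-patterns-coverable : {π : Perm n} →
  (∀ p → CoverableAway r s π p) →
  ∀ k (ρ : Perm k) → k < n → Contains π ρ → Coverable r s ρ
proper-patterns-coverable {n} away k ρ k<n ρ⊆π@(e , e-mono , _) =
  colouring⇒coverable {π = ρ} (restrict ρ⊆π C) λ {x} uncoloured → missed x (only-p uncoloured)
  where
  not-onto : ¬ (∀ p → ∃ λ x → e x ≡ p)
  not-onto onto = <⇒≱ k<n (injective⇒≤ λ {p} {q} eq → trans (sym (proj₂ (onto p))) (trans (cong e eq) (proj₂ (onto q))))
  p-missed = ¬∀⟶∃¬ n (λ p → ∃ λ x → e x ≡ p) (λ p → any? λ x → e x ≟ᶠ p) not-onto
  p = proj₁ p-missed
  missed : ∀ x → p ≢ e x
  missed x p≡ex = proj₂ p-missed (x , sym p≡ex)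
  C = proj₁ (away p)
  only-p = proj₂ (away p)

punchIn-mono-< : ∀ (i : Fin (suc n)) {x y} → x <ᶠ y → punchIn i x <ᶠ punchIn i y
punchIn-mono-< i {x} {y} x<y = ≤∧≢⇒< (punchIn-mono-≤ i x y (<⇒≤ x<y)) (<ᶠ⇒≢ x<y ∘ punchIn-injective i x y)

punchOut-mono-< : ∀ {i x y : Fin (suc n)} (i≢x : i ≢ x) (i≢y : i ≢ y) → x <ᶠ y → punchOut i≢x <ᶠ punchOut i≢y
punchOut-mono-< i≢x i≢y x<y =
  ≤∧≢⇒< (punchOut-mono-≤ i≢x i≢y (<⇒≤ x<y)) (<ᶠ⇒≢ x<y ∘ punchOut-injective i≢x i≢y)

punchOut-cancel-< : ∀ {i x y : Fin (suc n)} (i≢x : i ≢ x) (i≢y : i ≢ y) → punchOut i≢x <ᶠ punchOut i≢y → x <ᶠ y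
punchOut-cancel-< {i = i} i≢x i≢y lt =
  ≤∧≢⇒< (punchOut-cancel-≤ i≢x i≢y (<⇒≤ lt)) (<ᶠ⇒≢ lt ∘ punchOut-cong i)

module _ (σ : Perm (suc n)) (i : Fin (suc n)) where

  private
    σi≢σ[punchIn] : ∀ x → fun σ i ≢ fun σ (punchIn i x)
    σi≢σ[punchIn] x eq = punchInᵢ≢i i x (sym (fun-injective σ eq))

  delete : Perm n
  delete = perm f (injective , surjective)
    where
    f : Fin n → Fin n
    f x = punchOut (σi≢σ[punchIn] x)
    injective : Injective _≡_ _≡_ f
    injective eq = punchIn-injective i _ _ (fun-injective σ (punchOut-injective (σi≢σ[punchIn] _) (σi≢σ[punchIn] _) eq))
    surjective : ∀ y → ∃ λ x → ∀ {z} → z ≡ x → f z ≡ y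
    surjective y = punchOut i≢x , λ { refl →
      trans (punchOut-cong (fun σ i) (trans (cong (fun σ) (punchIn-punchOut i≢x)) σx≡)) (punchOut-punchIn (fun σ i)) }
      where
      x = proj₁ (proj₂ (bij σ) (punchIn (fun σ i) y))
      σx≡ : fun σ x ≡ punchIn (fun σ i) y
      σx≡ = proj₂ (proj₂ (bij σ) (punchIn (fun σ i) y)) refl
      i≢x : i ≢ x
      i≢x i≡x = punchInᵢ≢i (fun σ i) y (sym (trans (cong (fun σ) i≡x) σx≡))

  delete-order : ∀ {x y} → fun delete x <ᶠ fun delete y → fun σ (punchIn i x) <ᶠ fun σ (punchIn i y)
  delete-order = punchOut-cancel-< (σi≢σ[punchIn] _) (σi≢σ[punchIn] _)

  contains-delete : Contains σ delete
  contains-delete = punchIn i , (λ _ _ → punchIn-mono-< i) ,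
    λ _ _ → delete-order , punchOut-mono-< (σi≢σ[punchIn] _) (σi≢σ[punchIn] _)

  coverableAway : Coverable r s delete → CoverableAway r s σ i
  coverableAway {r} {s} cover = C , λ {x} → lift-nothing x (i ≟ᶠ x)
    where
    D = proj₁ (coverable⇒colouring {π = delete} cover)

    lift : ∀ x → Dec (i ≡ x) → Maybe (Fin r ⊎ Fin s)
    lift x (yes _)  = nothing
    lift x (no i≢x) = colour D (punchOut i≢x)

    lift-just : ∀ x d {c} → lift x d ≡ just c → Σ (i ≢ x) λ i≢x → colour D (punchOut i≢x) ≡ just c
    lift-just x (no i≢x) cx = i≢x , cx

    lift-nothing : ∀ x d → lift x d ≡ nothing → i ≡ x
    lift-nothing x (yes i≡x) _ = i≡x
    lift-nothing x (no i≢x) cx = contradiction cx (λ ())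

    lifted-order : ∀ {x y} (i≢x : i ≢ x) (i≢y : i ≢ y) →
      fun delete (punchOut i≢x) <ᶠ fun delete (punchOut i≢y) → fun σ x <ᶠ fun σ y
    lifted-order i≢x i≢y lt =
      subst₂ (λ x y → fun σ x <ᶠ fun σ y) (punchIn-punchOut i≢x) (punchIn-punchOut i≢y) (delete-order lt)

    C : Colouring (Fin r) (Fin s) σ
    C .colour x = lift x (i ≟ᶠ x)
    C .increasing a {x} {y} cx cy x<y with lift-just x (i ≟ᶠ x) cx | lift-just y (i ≟ᶠ y) cy
    ... | i≢x , cx′ | i≢y , cy′ = lifted-order i≢x i≢y (increasing D a cx′ cy′ (punchOut-mono-< i≢x i≢y x<y))
    C .decreasing b {x} {y} cx cy x<y with lift-just x (i ≟ᶠ x) cx | lift-just y (i ≟ᶠ y) cy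
    ... | i≢x , cx′ | i≢y , cy′ = lifted-order i≢y i≢x (decreasing D b cx′ cy′ (punchOut-mono-< i≢x i≢y x<y))

critical⇒coverableAway : {σ : Perm n} → Critical r s σ → (i : Fin n) → CoverableAway r s σ i
critical⇒coverableAway {suc n} {σ = σ} (_ , patterns-coverable) i =
  coverableAway σ i (patterns-coverable n (delete σ i) (n<1+n n) (contains-delete σ i))

-- Inflation

combine-monoʳ-< : (a : Fin m) {b b′ : Fin n} → b <ᶠ b′ → combine a b <ᶠ combine a b′
combine-monoʳ-< {n = n} a {b} {b′} b<b′ =
  subst₂ _<_ (sym (toℕ-combine a b)) (sym (toℕ-combine a b′)) (+-monoʳ-< (n * toℕ a) b<b′)

combine-<-cases : {a a′ : Fin m} {b b′ : Fin n} → combine a b <ᶠ combine a′ b′ → a <ᶠ a′ ⊎ (a ≡ a′ × b <ᶠ b′)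
combine-<-cases {n = n} {a} {a′} {b} {b′} lt with <-cmp a a′
... | tri< a<a′ _ _ = inj₁ a<a′
... | tri≈ _ refl _ = inj₂ (refl , +-cancelˡ-< (n * toℕ a) (toℕ b) (toℕ b′)
                                     (subst₂ _<_ (toℕ-combine a b) (toℕ-combine a b′) lt))
... | tri> _ _ a′<a = contradiction lt (<-asym (combine-monoˡ-< b′ b a′<a))

combine-cancelˡ-≤ : {a a′ : Fin m} {b b′ : Fin n} → combine a b <ᶠ combine a′ b′ → a ≤ᶠ a′
combine-cancelˡ-≤ {a = a} {a′} lt with combine-<-cases {a = a} {a′} lt
... | inj₁ a<a′ = <⇒≤ a<a′
... | inj₂ (refl , _) = ≤-reflexive refl

combine-cancelʳ-< : {a : Fin m} {b b′ : Fin n} → combine a b <ᶠ combine a b′ → b <ᶠ b′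
combine-cancelʳ-< {a = a} lt with combine-<-cases {a = a} {a} lt
... | inj₁ a<a = contradiction a<a (<-irrefl refl)
... | inj₂ (_ , b<b′) = b<b′

module _ {m : ℕ} (n : ℕ) where

  quotient-combine : (k : Fin m) (l : Fin n) → quotient {m} n (combine k l) ≡ k
  quotient-combine k l = cong proj₁ (remQuot-combine k l)

  remainder-combine : (k : Fin m) (l : Fin n) → remainder {m} n (combine k l) ≡ l
  remainder-combine k l = cong proj₂ (remQuot-combine k l)

  combine-quotient-remainder : (x : Fin (m * n)) → combine (quotient {m} n x) (remainder {m} n x) ≡ x
  combine-quotient-remainder = combine-remQuot {m} n

  <-blocks : {x y : Fin (m * n)} → x <ᶠ y →
    quotient {m} n x <ᶠ quotient {m} n y ⊎ (quotient {m} n x ≡ quotient {m} n y × remainder {m} n x <ᶠ remainder {m} n y)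
  <-blocks {x} {y} x<y = combine-<-cases {a = quotient {m} n x} {quotient {m} n y}
    (subst₂ _<ᶠ_ (sym (combine-quotient-remainder x)) (sym (combine-quotient-remainder y)) x<y)

_[_] : Perm m → Perm n → Perm (m * n)
_[_] {m} {n} σ τ = perm f (injective , surjective)
  where
  f : Fin (m * n) → Fin (m * n)
  f x = combine (fun σ (quotient {m} n x)) (fun τ (remainder {m} n x))
  injective : Injective _≡_ _≡_ f
  injective {x} {y} eq with combine-injective _ _ _ _ eq
  ... | σ≡ , τ≡ = trans (sym (combine-quotient-remainder {m} n x))
    (trans (cong₂ combine (fun-injective σ σ≡) (fun-injective τ τ≡)) (combine-quotient-remainder {m} n y))
  surjective : ∀ y → ∃ λ x → ∀ {z} → z ≡ x → f z ≡ y
  surjective y = combine k l , λ { refl → trans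
      (cong₂ combine (trans (cong (fun σ) (quotient-combine n k l)) σk≡) (trans (cong (fun τ) (remainder-combine n k l)) τl≡))
      (combine-quotient-remainder {m} n y) }
    where
    k = proj₁ (proj₂ (bij σ) (quotient {m} n y))
    σk≡ = proj₂ (proj₂ (bij σ) (quotient {m} n y)) refl
    l = proj₁ (proj₂ (bij τ) (remainder {m} n y))
    τl≡ = proj₂ (proj₂ (bij τ) (remainder {m} n y)) refl

module _ {m n} (σ : Perm m) (τ : Perm n) where

  private
    quot : Fin (m * n) → Fin m
    quot = quotient {m} n
    rem : Fin (m * n) → Fin n
    rem = remainder {m} n

  inflation-combine : ∀ k l → fun (σ [ τ ]) (combine k l) ≡ combine (fun σ k) (fun τ l)
  inflation-combine k l = cong₂ combine (cong (fun σ) (quotient-combine n k l)) (cong (fun τ) (remainder-combine n k l))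

  inflation-increasing : (Q : Fin m → Fin n → Set ℓ) →
    (∀ {k l l′} → Q k l → Q k l′ → l <ᶠ l′ → fun τ l <ᶠ fun τ l′) →
    (∀ {k k′ l l′} → Q k l → Q k′ l′ → k <ᶠ k′ → fun σ k <ᶠ fun σ k′) →
    Increasing (σ [ τ ]) (λ x → Q (quot x) (rem x))
  inflation-increasing Q within across {x} {y} Qx Qy x<y with <-blocks {m} n x<y
  ... | inj₁ qx<qy = combine-monoˡ-< _ _ (across Qx Qy qx<qy)
  ... | inj₂ (qx≡qy , rx<ry) =
    subst (λ k → combine (fun σ (quot x)) (fun τ (rem x)) <ᶠ combine (fun σ k) (fun τ (rem y))) qx≡qy
      (combine-monoʳ-< (fun σ (quot x)) (within Qx (subst (λ k → Q k (rem y)) (sym qx≡qy) Qy) rx<ry))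

  inflation-decreasing : (Q : Fin m → Fin n → Set ℓ) →
    (∀ {k l l′} → Q k l → Q k l′ → l <ᶠ l′ → fun τ l′ <ᶠ fun τ l) →
    (∀ {k k′ l l′} → Q k l → Q k′ l′ → k <ᶠ k′ → fun σ k′ <ᶠ fun σ k) →
    Decreasing (σ [ τ ]) (λ x → Q (quot x) (rem x))
  inflation-decreasing Q within across {x} {y} Qx Qy x<y with <-blocks {m} n x<y
  ... | inj₁ qx<qy = combine-monoˡ-< _ _ (across Qx Qy qx<qy)
  ... | inj₂ (qx≡qy , rx<ry) =
    subst (λ k → combine (fun σ k) (fun τ (rem y)) <ᶠ combine (fun σ (quot x)) (fun τ (rem x))) qx≡qy
      (combine-monoʳ-< (fun σ (quot x)) (within Qx (subst (λ k → Q k (rem y)) (sym qx≡qy) Qy) rx<ry))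

  inflate : (C : Fin m → Colouring A B τ) →
    (∀ {a k k′ l l′} → colour (C k) l ≡ just (inj₁ a) → colour (C k′) l′ ≡ just (inj₁ a) →
      k <ᶠ k′ → fun σ k <ᶠ fun σ k′) →
    (∀ {b k k′ l l′} → colour (C k) l ≡ just (inj₂ b) → colour (C k′) l′ ≡ just (inj₂ b) →
      k <ᶠ k′ → fun σ k′ <ᶠ fun σ k) →
    Colouring A B (σ [ τ ])
  inflate C _ _ .colour x = colour (C (quot x)) (rem x)
  inflate C across _ .increasing a = inflation-increasing (λ k l → colour (C k) l ≡ just (inj₁ a)) (increasing (C _) a) across
  inflate C _ across .decreasing b = inflation-decreasing (λ k l → colour (C k) l ≡ just (inj₂ b)) (decreasing (C _) b) across

  private
    inflation-<-combine : ∀ {k k′ l l′} → fun (σ [ τ ]) (combine k l) <ᶠ fun (σ [ τ ]) (combine k′ l′) →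
      combine (fun σ k) (fun τ l) <ᶠ combine (fun σ k′) (fun τ l′)
    inflation-<-combine = subst₂ _<ᶠ_ (inflation-combine _ _) (inflation-combine _ _)

  block : Colouring A B (σ [ τ ]) → Fin m → Colouring A B τ
  block C k .colour l = colour C (combine k l)
  block C k .increasing a cx cy l<l′ =
    combine-cancelʳ-< {a = fun σ k} (inflation-<-combine (increasing C a cx cy (combine-monoʳ-< k l<l′)))
  block C k .decreasing b cx cy l<l′ =
    combine-cancelʳ-< {a = fun σ k} (inflation-<-combine (decreasing C b cx cy (combine-monoʳ-< k l<l′)))

  increasing-across : ∀ {P : Fin (m * n) → Set ℓ} → Increasing (σ [ τ ]) P →
    ∀ {k k′ l l′} → P (combine k l) → P (combine k′ l′) → k <ᶠ k′ → fun σ k ≤ᶠ fun σ k′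
  increasing-across increasing Px Py k<k′ = combine-cancelˡ-≤ (inflation-<-combine (increasing Px Py (combine-monoˡ-< _ _ k<k′)))

  decreasing-across : ∀ {P : Fin (m * n) → Set ℓ} → Decreasing (σ [ τ ]) P →
    ∀ {k k′ l l′} → P (combine k l) → P (combine k′ l′) → k <ᶠ k′ → fun σ k′ ≤ᶠ fun σ k
  decreasing-across decreasing Px Py k<k′ = combine-cancelˡ-≤ (inflation-<-combine (decreasing Px Py (combine-monoˡ-< _ _ k<k′)))

inflation-decreasingCover : ∀ {m n s t} {σ : Perm m} {τ : Perm n} →
  DecreasingCover s σ → DecreasingCover t τ → DecreasingCover (s * t) (σ [ τ ])
inflation-decreasingCover {m} {n} {σ = σ} {τ} (g , g-decreasing) (h , h-decreasing) =
  (λ x → combine (g (quotient {m} n x)) (h (remainder {m} n x))) , λ c →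
    inflation-decreasing σ τ (λ k l → combine (g k) (h l) ≡ c)
      (λ {k} {l} {l′} e e′ →
        h-decreasing (h l) refl (sym (combine-injectiveʳ (g k) (h l) (g k) (h l′) (trans e (sym e′)))))
      (λ {k} {k′} {l} {l′} e e′ →
        g-decreasing (g k) refl (sym (combine-injectiveˡ (g k) (h l) (g k′) (h l′) (trans e (sym e′)))))

-- The inflation is not (ac − 1, bd − 1)-coverable

module Reach {m C : ℕ} (_≺_ : Fin m → Fin m → Set ℓ) (≺-trans : ∀ {x y z} → x ≺ y → y ≺ z → x ≺ z)
  (_≺?_ : ∀ x y → Dec (x ≺ y)) (Used : Fin m → Pred (Fin C) ℓ′) (used? : ∀ k → Decidable (Used k))
  (exclusive : ∀ {z k c} → z ≺ k → Used z c → ¬ Used k c) where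

  Reached : Fin m → Pred (Fin C) _
  Reached k c = ∃ λ z → (z ≡ k ⊎ z ≺ k) × Used z c

  reached? : ∀ k → Decidable (Reached k)
  reached? k c = any? λ z → ((z ≟ᶠ k) ⊎-dec (z ≺? k)) ×-dec used? z c

  uses : Fin m → ℕ
  uses k = count (used? k)

  uses-pos : ∀ {k c} → Used k c → 0 < uses k
  uses-pos = count-pos (used? _)

  reach : Fin m → ℕ
  reach k = count (reached? k)

  used≤reach : ∀ k → uses k ≤ reach k
  used≤reach k = count-mono (used? k) (reached? k) λ u → k , inj₁ refl , u

  reach≤ : ∀ k → reach k ≤ C
  reach≤ k = count≤n (reached? k)

  reach-step : ∀ {k k′} → k ≺ k′ → reach k + uses k′ ≤ reach k′
  reach-step {k} {k′} k≺k′ = count-⊎ (reached? k) (used? k′) (reached? k′)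
    (λ ((z , z≼k , u) , u′) → exclusive (below z≼k) u u′)
    (λ (z , z≼k , u) → z , inj₂ (below z≼k) , u)
    (λ u → k′ , inj₁ refl , u)
    where
    below : ∀ {z} → z ≡ k ⊎ z ≺ k → z ≺ k′
    below (inj₁ refl) = k≺k′
    below (inj₂ z≺k)  = ≺-trans z≺k k≺k′

tier : ℕ → ℕ → ℕ
tier c κ = (κ ∸ suc c) / suc c

tier< : ∀ a c {κ} → suc c ≤ κ → κ ≤ c + a * suc c → tier c κ < a
tier< a c {κ} c<κ κ≤ =
  m<n*o⇒m/o<n (subst (κ ∸ suc c <_) (m+n∸m≡n (suc c) (a * suc c)) (∸-monoˡ-< (s≤s κ≤) c<κ))

tier-< : ∀ c {κ κ′} → suc c ≤ κ → κ + suc c ≤ κ′ → tier c κ < tier c κ′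
tier-< c {κ} {κ′} c<κ κ+c<κ′ = begin-strict
  tier c κ                  <⟨ n<1+n _ ⟩
  suc (tier c κ)            ≡⟨ m/n≡1+[m∸n]/n c<κ ⟨
  κ / suc c                 ≤⟨ /-monoˡ-≤ (suc c) (m+n≤o⇒m≤o∸n κ κ+c<κ′) ⟩
  tier c κ′                 ∎
  where open ≤-Reasoning

module BlockQuotient {m n a b c d} {σ : Perm m} {τ : Perm n} (¬τ : ¬ Coverable c d τ)
  (C : Colouring (Fin (c + a * suc c)) (Fin (d + b * suc d)) (σ [ τ ])) (total : Uncoloured C ⊆ ∅) where

  incColours decColours : Fin m → ℕ
  incColours k = count (usedInc? (block σ τ C k))
  decColours k = count (usedDec? (block σ τ C k))

  few-inc⇒many-dec : ∀ k → ¬ suc c ≤ incColours k → suc d ≤ decColours k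
  few-inc⇒many-dec k few-inc with suc d ≤? decColours k
  ... | yes many-dec = many-dec
  ... | no few-dec = contradiction (colouring⇒coverable {π = τ} (proj₁ compressed) (total ∘ proj₂ compressed)) ¬τ
    where
    compressed = compress (block σ τ C k) (≤-pred (≰⇒> few-inc)) (≤-pred (≰⇒> few-dec))

  module I = Reach (Descent σ) (descent-trans σ) (descent? σ)
    (λ k → UsedInc (block σ τ C k)) (λ k → usedInc? (block σ τ C k))
    (λ (z<k , σk<σz) (_ , u) (_ , u′) → ≤⇒≯ (increasing-across σ τ (increasing C _) u u′ z<k) σk<σz)
  module D = Reach (Ascent σ) (ascent-trans σ) (ascent? σ)
    (λ k → UsedDec (block σ τ C k)) (λ k → usedDec? (block σ τ C k))
    (λ (z<k , σz<σk) (_ , u) (_ , u′) → ≤⇒≯ (decreasing-across σ τ (decreasing C _) u u′ z<k) σz<σk)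

  blockColour : ∀ k → Dec (suc c ≤ incColours k) → Fin a ⊎ Fin b
  blockColour k (yes many-inc) = inj₁ (fromℕ< (tier< a c (≤-trans many-inc (I.used≤reach k)) (I.reach≤ k)))
  blockColour k (no few-inc)   =
    inj₂ (fromℕ< (tier< b d (≤-trans (few-inc⇒many-dec k few-inc) (D.used≤reach k)) (D.reach≤ k)))

  blockColour-inj₁ : ∀ k dec {v} → blockColour k dec ≡ inj₁ v → suc c ≤ incColours k × tier c (I.reach k) ≡ toℕ v
  blockColour-inj₁ k (yes many-inc) refl = many-inc , sym (toℕ-fromℕ< _)

  blockColour-inj₂ : ∀ k dec {v} → blockColour k dec ≡ inj₂ v → suc d ≤ decColours k × tier d (D.reach k) ≡ toℕ v
  blockColour-inj₂ k (no few-inc) refl = few-inc⇒many-dec k few-inc , sym (toℕ-fromℕ< _)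

  quotient-colouring : Colouring (Fin a) (Fin b) σ
  quotient-colouring .colour k = just (blockColour k (suc c ≤? incColours k))
  quotient-colouring .increasing v {k} {k′} ck ck′ k<k′
    with blockColour-inj₁ k _ (Maybe.just-injective ck) | blockColour-inj₁ k′ _ (Maybe.just-injective ck′)
  ... | many , tier≡ | many′ , tier≡′ = ascent-unless-descent σ k<k′ λ descent →
    <-irrefl (trans tier≡ (sym tier≡′))
      (tier-< c (≤-trans many (I.used≤reach k)) (≤-trans (+-monoʳ-≤ (I.reach k) many′) (I.reach-step descent)))
  quotient-colouring .decreasing v {k} {k′} ck ck′ k<k′
    with blockColour-inj₂ k _ (Maybe.just-injective ck) | blockColour-inj₂ k′ _ (Maybe.just-injective ck′)
  ... | many , tier≡ | many′ , tier≡′ = descent-unless-ascent σ k<k′ λ ascent →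
    <-irrefl (trans tier≡ (sym tier≡′))
      (tier-< d (≤-trans many (D.used≤reach k)) (≤-trans (+-monoʳ-≤ (D.reach k) many′) (D.reach-step ascent)))

inflation-not-coverable : ∀ {m n a b c d} {σ : Perm m} {τ : Perm n} →
  ¬ Coverable a b σ → ¬ Coverable c d τ → ¬ Coverable (c + a * suc c) (d + b * suc d) (σ [ τ ])
inflation-not-coverable {σ = σ} {τ} ¬σ ¬τ cover =
  ¬σ (colouring⇒coverable {π = σ} (BlockQuotient.quotient-colouring ¬τ (proj₁ C) (proj₂ C)) λ ())
  where
  C = coverable⇒colouring {π = σ [ τ ]} cover

-- The inflation minus any point is (ac − 1, bd − 1)-coverable

∸-+-< : ∀ {e o v} → o ≤ e → v < o → e ∸ o + v < e
∸-+-< {e} {o} {v} o≤e v<o = subst (e ∸ o + v <_) (m∸n+n≡m o≤e) (+-monoʳ-< (e ∸ o) v<o)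

module InflationAway {m n a b c d} {σ : Perm m} {τ : Perm n} {i : Fin m} {j : Fin n}
  (G : DecreasingCover (suc b) σ) (Cσ : Colouring (Fin a) (Fin b) σ) (Cσ-away : Uncoloured Cσ ⊆ ｛ i ｝)
  (H : DecreasingCover (suc d) τ) (Cτ : Colouring (Fin c) (Fin d) τ) (Cτ-away : Uncoloured Cτ ⊆ ｛ j ｝) where

  Class : Set
  Class = Maybe (Fin a ⊎ Fin b)

  _≟class_ : (s s′ : Class) → Dec (s ≡ s′)
  _≟class_ = Maybe.≡-dec (Sum.≡-dec _≟ᶠ_ _≟ᶠ_)

  weight : Class → ℕ
  weight (just (inj₂ _)) = 1
  weight _               = 0

  -- An increasing class of τ − j inside block i, or an increasing class of σ − i paired with one of τ − j or with {j}.
  IncColour : Set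
  IncColour = Fin c ⊎ (Fin a × Fin (suc c))

  σClass : IncColour → Class
  σClass (inj₁ _)       = nothing
  σClass (inj₂ (p , _)) = just (inj₁ p)

  localColouring : (s : Class) → Colouring IncColour (Fin (weight s + d)) τ
  localColouring nothing         = recolour {f = inj₁} {g = id} Sum.inj₁-injective id Cτ
  localColouring (just (inj₁ p)) = recolour {f = inj₂ ∘ (p ,_)} {g = id} (λ { refl → refl }) id (extend Cτ Cτ-away)
  localColouring (just (inj₂ _)) = decreasingColouring H

  localColouring-σClass : ∀ s {l x} → colour (localColouring s) l ≡ just (inj₁ x) → σClass x ≡ s
  localColouring-σClass nothing         cl with map-inj₁ {f = inj₁} {g = id} (colour Cτ _) cl
  ... | _ , _ , refl = refl
  localColouring-σClass (just (inj₁ p)) cl with map-inj₁ {f = inj₂ ∘ (p ,_)} {g = id} (colour (extend Cτ Cτ-away) _) cl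
  ... | _ , _ , refl = refl
  localColouring-σClass (just (inj₂ _)) ()

  localColouring-uncoloured : ∀ s {l} → Uncoloured (localColouring s) l → s ≡ nothing × j ≡ l
  localColouring-uncoloured nothing         ul =
    refl , Cτ-away (recolour-uncoloured {f = inj₁} {g = id} Sum.inj₁-injective id Cτ ul)
  localColouring-uncoloured (just (inj₁ _)) ()
  localColouring-uncoloured (just (inj₂ _)) ()

  private
    g : Fin m → Fin (suc b)
    g = proj₁ G
    cs : Fin m → Class
    cs = colour Cσ
    width : Fin m → ℕ
    width k = weight (cs k) + d
    S : ℕ
    S = d + b * suc d

  module Λ = Reach (Ascent σ) (ascent-trans σ) (ascent? σ) (λ k u → g k ≡ u) (λ k u → g k ≟ᶠ u)
    (λ (z<k , σz<σk) gz gk → <-asym σz<σk (proj₂ G _ gz gk z<k))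
  module Δ = Reach (Ascent σ) (ascent-trans σ) (ascent? σ)
    (λ k q → cs k ≡ just (inj₂ q)) (λ k q → cs k ≟class just (inj₂ q))
    (λ (z<k , σz<σk) u u′ → <-asym σz<σk (decreasing Cσ _ u u′ z<k))

  -- Block k draws its decreasing colours from the window [level k ∸ width k, level k).  Along an
  -- ascent k → k′ of σ the level grows by at least width k′, so these windows are disjoint.
  level : Fin m → ℕ
  level k = d * Λ.reach k + Δ.reach k

  weight≤Δ-uses : ∀ k → weight (cs k) ≤ Δ.uses k
  weight≤Δ-uses k = weight≤ (cs k) refl
    where
    weight≤ : ∀ s → cs k ≡ s → weight s ≤ Δ.uses k
    weight≤ nothing         _  = z≤n
    weight≤ (just (inj₁ _)) _  = z≤n
    weight≤ (just (inj₂ _)) ck = Δ.uses-pos ck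

  width≤level : ∀ k → width k ≤ level k
  width≤level k =
    subst (_≤ level k) (+-comm d (weight (cs k))) (+-mono-≤ d≤d*Λ (≤-trans (weight≤Δ-uses k) (Δ.used≤reach k)))
    where
    d≤d*Λ : d ≤ d * Λ.reach k
    d≤d*Λ = subst (_≤ d * Λ.reach k) (*-identityʳ d) (*-monoʳ-≤ d (≤-trans (Λ.uses-pos refl) (Λ.used≤reach k)))

  level≤ : ∀ k → level k ≤ S
  level≤ k = subst (level k ≤_) (solve 2 (λ b d → d :* (con 1 :+ b) :+ b := d :+ b :* (con 1 :+ d)) refl b d)
    (+-mono-≤ (*-monoʳ-≤ d (Λ.reach≤ k)) (Δ.reach≤ k))

  level-step : ∀ {k k′} → Ascent σ k k′ → level k + width k′ ≤ level k′
  level-step {k} {k′} ascent = begin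
    level k + width k′
      ≡⟨ solve 4 (λ d L D w → d :* L :+ D :+ (w :+ d) := d :* (L :+ con 1) :+ (D :+ w)) refl
           d (Λ.reach k) (Δ.reach k) (weight (cs k′)) ⟩
    d * (Λ.reach k + 1) + (Δ.reach k + weight (cs k′))
      ≤⟨ +-mono-≤ (*-monoʳ-≤ d Λ-step) Δ-step ⟩
    level k′ ∎
    where
    open ≤-Reasoning
    Λ-step : Λ.reach k + 1 ≤ Λ.reach k′
    Λ-step = ≤-trans (+-monoʳ-≤ (Λ.reach k) (Λ.uses-pos refl)) (Λ.reach-step ascent)
    Δ-step : Δ.reach k + weight (cs k′) ≤ Δ.reach k′
    Δ-step = ≤-trans (+-monoʳ-≤ (Δ.reach k) (weight≤Δ-uses k′)) (Δ.reach-step ascent)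

  window : ∀ k → Fin (width k) → Fin S
  window k v = fromℕ< (<-≤-trans (∸-+-< (width≤level k) (toℕ<n v)) (level≤ k))

  window-injective : ∀ k → Injective _≡_ _≡_ (window k)
  window-injective k {v} {v′} eq =
    toℕ-injective (+-cancelˡ-≡ (level k ∸ width k) (toℕ v) (toℕ v′) (fromℕ<-injective _ _ _ _ eq))

  blockColouring : Fin m → Colouring IncColour (Fin S) τ
  blockColouring k = recolour {f = id} {g = window k} id (window-injective k) (localColouring (cs k))

  block-σClass : ∀ {k l x} → colour (blockColouring k) l ≡ just (inj₁ x) → σClass x ≡ cs k
  block-σClass {k} cl with map-inj₁ {f = id} {g = window k} (colour (localColouring (cs k)) _) cl
  ... | _ , cl′ , refl = localColouring-σClass (cs k) cl′

  block-window : ∀ {k l y} → colour (blockColouring k) l ≡ just (inj₂ y) → level k ∸ width k ≤ toℕ y × toℕ y < level k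
  block-window {k} cl with map-inj₂ {f = id} {g = window k} (colour (localColouring (cs k)) _) cl
  ... | v , _ , refl rewrite toℕ-fromℕ< (<-≤-trans (∸-+-< (width≤level k) (toℕ<n v)) (level≤ k)) =
    m≤m+n _ _ , ∸-+-< (width≤level k) (toℕ<n v)

  across-inc : ∀ {x k k′ l l′} →
    colour (blockColouring k) l ≡ just (inj₁ x) → colour (blockColouring k′) l′ ≡ just (inj₁ x) → k <ᶠ k′ → fun σ k <ᶠ fun σ k′
  across-inc {x} cl cl′ = same-class x (block-σClass cl) (block-σClass cl′)
    where
    same-class : ∀ {k k′} x → σClass x ≡ cs k → σClass x ≡ cs k′ → k <ᶠ k′ → fun σ k <ᶠ fun σ k′
    same-class (inj₁ _)       e e′ k<k′ = contradiction (trans (sym (Cσ-away (sym e))) (Cσ-away (sym e′))) (<ᶠ⇒≢ k<k′)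
    same-class (inj₂ (p , _)) e e′ k<k′ = increasing Cσ p (sym e) (sym e′) k<k′

  across-dec : ∀ {y k k′ l l′} →
    colour (blockColouring k) l ≡ just (inj₂ y) → colour (blockColouring k′) l′ ≡ just (inj₂ y) → k <ᶠ k′ → fun σ k′ <ᶠ fun σ k
  across-dec cl cl′ k<k′ = descent-unless-ascent σ k<k′ λ ascent →
    <-irrefl refl (<-≤-trans (proj₂ (block-window cl))
      (≤-trans (m+n≤o⇒m≤o∸n _ (level-step ascent)) (proj₁ (block-window cl′))))

  encode : IncColour → Fin (c + a * suc c)
  encode (inj₁ t)       = t ↑ˡ (a * suc c)
  encode (inj₂ (p , t)) = c ↑ʳ combine p t

  encode-injective : Injective _≡_ _≡_ encode
  encode-injective {inj₁ t}       {inj₁ t′}       eq = cong inj₁ (↑ˡ-injective _ t t′ eq)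
  encode-injective {inj₁ t}       {inj₂ _}        eq = contradiction (subst (λ x → toℕ x < c) eq (↑ˡ-< t _)) (↑ʳ-≮ c _)
  encode-injective {inj₂ _}       {inj₁ t′}       eq = contradiction (subst (λ x → toℕ x < c) (sym eq) (↑ˡ-< t′ _)) (↑ʳ-≮ c _)
  encode-injective {inj₂ (p , t)} {inj₂ (p′ , t′)} eq with combine-injective p t p′ t′ (↑ʳ-injective c _ _ eq)
  ... | refl , refl = refl

  inflated : Colouring IncColour (Fin S) (σ [ τ ])
  inflated = inflate σ τ blockColouring across-inc across-dec

  inflation-colouring : Colouring (Fin (c + a * suc c)) (Fin S) (σ [ τ ])
  inflation-colouring = recolour {f = encode} {g = id} encode-injective id inflated

  inflation-uncoloured : Uncoloured inflation-colouring ⊆ ｛ combine i j ｝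
  inflation-uncoloured {x} ux with localColouring-uncoloured (cs (quotient {m} n x))
    (recolour-uncoloured {f = id} {g = window _} id (window-injective _) (localColouring (cs _))
      (recolour-uncoloured {f = encode} {g = id} encode-injective id inflated ux))
  ... | cs≡nothing , j≡r = trans (cong₂ combine (Cσ-away cs≡nothing) j≡r) (combine-quotient-remainder {m} n x)

inflation-sharp : ∀ {m n a b c d} {σ : Perm m} {τ : Perm n} →
  Sharp a b σ → Sharp c d τ → Sharp (c + a * suc c) (d + b * suc d) (σ [ τ ])
inflation-sharp {m} {n} {a} {b} {c} {d} {σ} {τ} (σ-critical , σ-dec) (τ-critical , τ-dec) =
  (inflation-not-coverable {σ = σ} {τ} (proj₁ σ-critical) (proj₁ τ-critical) , proper-patterns-coverable away) ,
  decreasingCover⇒coverable {π = σ [ τ ]} (inflation-decreasingCover {σ = σ} {τ} G H)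
  where
  G = decreasingCover {π = σ} σ-dec
  H = decreasingCover {π = τ} τ-dec
  away : ∀ p → CoverableAway (c + a * suc c) (d + b * suc d) (σ [ τ ]) p
  away p = A.inflation-colouring , λ ux → trans (sym (combine-quotient-remainder {m} n p)) (A.inflation-uncoloured ux)
    where
    Cσ = critical⇒coverableAway σ-critical (quotient {m} n p)
    Cτ = critical⇒coverableAway τ-critical (remainder {m} n p)
    module A = InflationAway G (proj₁ Cσ) (proj₂ Cσ) H (proj₁ Cτ) (proj₂ Cτ)

lemma8 : (a b c d : ℕ) → 0 < a → 0 < b → 0 < c → 0 < d →
    ∀ {m n} (σ : Perm m) (τ : Perm n) →
    Sharp (a ∸ 1) (b ∸ 1) σ → Sharp (c ∸ 1) (d ∸ 1) τ →
    S≥ (a * c ∸ 1) (b * d ∸ 1) (m * n)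
lemma8 (suc a) (suc b) (suc c) (suc d) _ _ _ _ {m} {n} σ τ σ-sharp τ-sharp =
  inj₂ (m * n , σ [ τ ] , inflation-sharp {a = a} {b} {c} {d} {σ} {τ} σ-sharp τ-sharp , ≤-refl)
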